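{- Let $\mathcal{C}\subseteq\mathbb{N}^N$ be a $\oplus$-submonoid of $\mathbb{N}^N$ containing a nonzero vector. Assume there is a group $G$ of permutations of $N$, acting transitively on $N$, such that for every $\pi\in G$ the coordinate permutation $a\mapsto a'$ with $a'_{\pi(i)}=a_i$ maps $\mathcal{C}$ onto itself. Then every $\oplus$-automorphism of $\mathcal{C}$ fixes $r\mathbf{1}$ for some positive integer $r$.
   Context: $N$ is a finite set, $\mathbb{N}=\{0,1,2,\dots\}$, $\mathbf{1}$ is the all-ones vector, $(u\oplus v)_i=\max(u_i,v_i)$. A $\oplus$-submonoid of $\mathbb{N}^N$ is a subset containing $0$ and closed under $\oplus$. A $\oplus$-automorphism of $\mathcal{C}$ is a bijection $\phi:\mathcal{C}\to\mathcal{C}$ with $\phi(u\oplus v)=\phi(u)\oplus\phi(v)$. -}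

module Defs where

open import Data.Nat using (ℕ; zero; suc; _⊔_)
open import Data.Fin using (Fin)
open import Data.Product using (Σ; ∃; _×_; _,_)
open import Relation.Binary.PropositionalEquality using (_≡_)
open import Relation.Nullary using (¬_)
open import Function.Bundles using (_↔_; Inverse)
open import Level using (Level; _⊔_) renaming (suc to lsuc; zero to lzero)

Vecℕ : ℕ → Set
Vecℕ n = Fin n → ℕ

_≈ᵥ_ : ∀ {n} → Vecℕ n → Vecℕ n → Set
u ≈ᵥ v = ∀ i → u i ≡ v i

_⊕_ : ∀ {n} → Vecℕ n → Vecℕ n → Vecℕ n
(u ⊕ v) i = u i Data.Nat.⊔ v i

𝟘 : ∀ {n} → Vecℕ n
𝟘 _ = 0

const : ∀ {n} → ℕ → Vecℕ n
const r _ = r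

Subset : ℕ → Set₁
Subset n = Vecℕ n → Set

Extensional : ∀ {n} → Subset n → Set
Extensional C = ∀ {u v} → u ≈ᵥ v → C u → C v

record IsSubmonoid {n} (C : Subset n) : Set where
  field
    ext     : Extensional C
    has-0   : C 𝟘
    closed  : ∀ {u v} → C u → C v → C (u ⊕ v)

record IsAutomorphism {n} (C : Subset n) (φ : Vecℕ n → Vecℕ n) : Set where
  field
    maps-into  : ∀ {u} → C u → C (φ u)
    respects   : ∀ {u v} → C u → C v → u ≈ᵥ v → φ u ≈ᵥ φ v
    injective  : ∀ {u v} → C u → C v → φ u ≈ᵥ φ v → u ≈ᵥ v
    surjective : ∀ {v} → C v → Σ (Vecℕ n) λ u → C u × (φ u ≈ᵥ v)
    hom        : ∀ {u v} → C u → C v → φ (u ⊕ v) ≈ᵥ (φ u ⊕ φ v)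

Perm : ℕ → Set
Perm n = Fin n ↔ Fin n

record IsPermGroup {n} (G : Perm n → Set) : Set where
  open Inverse
  field
    has-id  : Σ (Perm n) λ e → G e × (∀ i → to e i ≡ i)
    comp    : ∀ {π σ} → G π → G σ →
              Σ (Perm n) λ ρ → G ρ × (∀ i → to ρ i ≡ to π (to σ i))
    inv     : ∀ {π} → G π →
              Σ (Perm n) λ ρ → G ρ × (∀ i → to ρ i ≡ from π i)

Transitive : ∀ {n} → (Perm n → Set) → Set
Transitive {n} G = ∀ (i j : Fin n) → Σ (Perm n) λ π → G π × (Inverse.to π i ≡ j)

-- the coordinate permutation a ↦ a' with a'_{π(i)} = a_i, i.e. a' = a ∘ π⁻¹
permute : ∀ {n} → Perm n → Vecℕ n → Vecℕ n
permute π a j = a (Inverse.from π j)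

MapsOnto : ∀ {n} → Subset n → (Vecℕ n → Vecℕ n) → Set
MapsOnto {n} C f = (∀ {a} → C a → C (f a)) ×
                   (∀ {b} → C b → Σ (Vecℕ n) λ a → C a × (f a ≈ᵥ b))

-- Automorphisms of C are order automorphisms of (C, ≤), and two comparable points
-- of one automorphism orbit are equal: from α a ≤ β a one descends, along the
-- coordinate sum, to α a = β a.  By Dickson's lemma antichains in ℕ^N are finite,
-- so the orbit of a nonzero c ∈ C under the automorphisms generated by φ and the
-- permutations in G is finite.  Its join J lies in C and every generator maps it
-- below itself, hence fixes it; fixed by a transitive set of permutations, J = r𝟏
-- with r ≥ c_i > 0.
module Submission where

open import Defs
open import Data.Nat using (ℕ; zero; suc; _≤_; _<_; _>_; _+_; z≤n; _≤?_)
  renaming (_≟_ to _≟ℕ_)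
open import Data.Nat.Properties
  using (≤-trans; ≤-reflexive; ≤∧≢⇒<; <⇒≱; ≮⇒≥; m≤n⇒m<n∨m≡n;
         +-mono-≤; +-mono-≤-<; +-mono-<-≤; n≢0⇒n>0; m≤n⇒m⊔n≡n; m≤m⊔n; m≤n⊔m; ⊔-lub)
open import Data.Nat.Induction using (<-wellFounded)
open import Data.Fin using (Fin) renaming (zero to fzero; suc to fsuc; _≟_ to _≟ᶠ_)
open import Data.Fin.Properties using (¬∀⟶∃¬) renaming (all? to allFin?)
open import Data.Fin.Subset as Sub using (_∈_; _-_; ∣_∣; ⊤)
open import Data.Fin.Subset.Properties using (_∈?_; x∈p⇒∣p-x∣<∣p∣; x∈p∧x∉q⇒x∈p─q; x≢y⇒x∉⁅y⁆; ∈⊤)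
open import Data.List using (List; []; _∷_; foldr; map; allFin; cartesianProduct)
open import Data.List.Relation.Unary.Any as Any using (Any; here; there; any?)
open import Data.List.Relation.Unary.Any.Properties using (¬Any[])
open import Data.List.Relation.Unary.All as All using (All; []; _∷_; all?)
open import Data.List.Relation.Unary.All.Properties using (¬All⇒Any¬; Any¬⇒¬All)
open import Data.List.Membership.Propositional using (lose)
open import Data.List.Membership.Propositional.Properties using (∈-allFin; ∈-map⁺; ∈-cartesianProduct⁺)
open import Data.Product using (Σ; _×_; _,_; proj₁; proj₂)
open import Data.Sum using (_⊎_; inj₁; inj₂; [_,_]; map₁; map₂)
open import Data.Empty using (⊥; ⊥-elim)
open import Function using (_∘_)
open import Function.Bundles using (Inverse)
open import Induction.WellFounded using (Acc; acc)
open import Relation.Nullary using (¬_; Dec; yes; no)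
open import Relation.Nullary.Decidable using (decidable-stable; _→-dec_)
open import Relation.Binary.PropositionalEquality using (_≡_; _≢_; refl; sym; trans; cong; subst; subst₂; module ≡-Reasoning)

-- Barred _≼_ P: every sequence y₀, y₁, … that avoids P and in which no yⱼ lies
-- above an earlier yᵢ is finite.  Barred _≼_ (λ _ → ⊥) says that _≼_ is a wqo.
data Barred {A : Set} (_≼_ : A → A → Set) : (A → Set) → Set₁ where
  bar : ∀ {P} → (∀ y → ¬ P y → Barred _≼_ (λ z → P z ⊎ y ≼ z)) → Barred _≼_ P

module _ {A : Set} {_≼_ : A → A → Set} where

  Barred-mono : ∀ {P Q} → (∀ y → P y → Q y) → Barred _≼_ P → Barred _≼_ Q
  Barred-mono P⊆Q (bar f) =
    bar λ y ¬Qy → Barred-mono (λ z → map₁ (P⊆Q z)) (f y (¬Qy ∘ P⊆Q y))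

  Barred-∪ : ∀ {P Q₁ Q₂} → Barred _≼_ Q₁ → Barred _≼_ Q₂ →
             (∀ y → ¬ P y → ¬ Q₁ y ⊎ ¬ Q₂ y) → Barred _≼_ P
  Barred-∪ {P} {Q₁} {Q₂} b₁@(bar f₁) b₂@(bar f₂) cover = bar λ y ¬Py →
    [ (λ ¬Q₁y → Barred-∪ (f₁ y ¬Q₁y) b₂ λ z ¬z → map₁ (avoid {Q₁} ¬z) (cover z (¬z ∘ inj₁)))
    , (λ ¬Q₂y → Barred-∪ b₁ (f₂ y ¬Q₂y) λ z ¬z → map₂ (avoid {Q₂} ¬z) (cover z (¬z ∘ inj₁)))
    ] (cover y ¬Py)
    where
    avoid : ∀ {Q : A → Set} {y z} → ¬ (P z ⊎ y ≼ z) → ¬ Q z → ¬ (Q z ⊎ y ≼ z)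
    avoid ¬z ¬Qz = [ ¬Qz , ¬z ∘ inj₂ ]

  Barred-⋃ : ∀ {I : Set} {P} (Q : I → A → Set) → (∀ i y → Dec (Q i y)) → (is : List I) →
             (∀ i → Barred _≼_ (Q i)) → (∀ y → ¬ P y → Any (λ i → ¬ Q i y) is) → Barred _≼_ P
  Barred-⋃ Q Q? [] _ cover = bar λ y ¬Py → ⊥-elim (¬Any[] (cover y ¬Py))
  Barred-⋃ Q Q? (i ∷ is) barred cover =
    Barred-∪ (barred i) (Barred-⋃ Q Q? is barred λ y → ¬All⇒Any¬ (λ j → Q? j y) is)
      λ y ¬Py → split (cover y ¬Py)
    where
    split : ∀ {y} → Any (λ j → ¬ Q j y) (i ∷ is) → ¬ Q i y ⊎ ¬ All (λ j → Q j y) is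
    split (here ¬Qiy) = inj₁ ¬Qiy
    split (there ¬Qy) = inj₂ (Any¬⇒¬All ¬Qy)

Barred-transfer : ∀ {A : Set} {_≼_ _⊑_ : A → A → Set} {P Q} →
                  (∀ y → ¬ P y → ¬ Q y) → (∀ y z → ¬ P y → ¬ P z → y ⊑ z → y ≼ z) →
                  Barred _⊑_ Q → Barred _≼_ P
Barred-transfer ¬P⊆¬Q ⊑⇒≼ (bar f) = bar λ y ¬Py →
  Barred-transfer
    (λ z ¬z → [ ¬P⊆¬Q z (¬z ∘ inj₁) , (λ y⊑z → ¬z (inj₂ (⊑⇒≼ y z ¬Py (¬z ∘ inj₁) y⊑z))) ])
    (λ z z′ ¬z ¬z′ → ⊑⇒≼ z z′ (¬z ∘ inj₁) (¬z′ ∘ inj₁))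
    (f y (¬P⊆¬Q y ¬Py))

_≤ᵥ_ : ∀ {n} → Vecℕ n → Vecℕ n → Set
u ≤ᵥ v = ∀ i → u i ≤ v i

module Dickson {n : ℕ} where

  _≤[_]_ : Vecℕ n → Sub.Subset n → Vecℕ n → Set
  u ≤[ p ] v = ∀ i → i ∈ p → u i ≤ v i

  -- The complement of ↑x₀ is covered by the slabs {y i = a}, a < x₀ i, and on a
  -- slab the order only needs to be checked on the remaining coordinates p - i.
  barred-on : (p : Sub.Subset n) → Acc _<_ ∣ p ∣ → Barred _≤[ p ]_ (λ _ → ⊥)
  barred-on p (acc smaller) = bar λ x₀ _ →
    Barred-⋃ (λ i y → i ∈ p → x₀ i ≤ y i) (λ i y → (i ∈? p) →-dec (x₀ i ≤? y i))
      (allFin n) (λ i → above i (x₀ i)) (cover x₀)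
    where
    slab : ∀ {i} → i ∈ p → ∀ a → Barred _≤[ p ]_ (λ y → y i ≢ a)
    slab {i} i∈p a =
      Barred-transfer (λ _ _ ()) agree (barred-on (p - i) (smaller (x∈p⇒∣p-x∣<∣p∣ i∈p)))
      where
      agree : ∀ y z → ¬ y i ≢ a → ¬ z i ≢ a → y ≤[ p - i ] z → y ≤[ p ] z
      agree y z yi≡a zi≡a y≤z j j∈p with j ≟ᶠ i
      ... | yes refl = ≤-reflexive (trans (decidable-stable (y i ≟ℕ a) yi≡a)
                                          (sym (decidable-stable (z i ≟ℕ a) zi≡a)))
      ... | no j≢i = y≤z j (x∈p∧x∉q⇒x∈p─q j∈p (x≢y⇒x∉⁅y⁆ j≢i))

    bounded : ∀ {i} → i ∈ p → ∀ k → Barred _≤[ p ]_ (λ y → k ≤ y i)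
    bounded i∈p zero = bar λ _ ¬0≤ → ⊥-elim (¬0≤ z≤n)
    bounded {i} i∈p (suc k) = Barred-∪ (bounded i∈p k) (slab i∈p k) split
      where
      split : ∀ y → ¬ suc k ≤ y i → ¬ k ≤ y i ⊎ ¬ y i ≢ k
      split y k≮yi with m≤n⇒m<n∨m≡n (≮⇒≥ k≮yi)
      ... | inj₁ yi<k = inj₁ (<⇒≱ yi<k)
      ... | inj₂ yi≡k = inj₂ λ yi≢k → yi≢k yi≡k

    above : ∀ i k → Barred _≤[ p ]_ (λ y → i ∈ p → k ≤ y i)
    above i k with i ∈? p
    ... | yes i∈p = Barred-mono (λ _ k≤yi _ → k≤yi) (bounded i∈p k)
    ... | no i∉p = bar λ _ ¬P → ⊥-elim (¬P (⊥-elim ∘ i∉p))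

    cover : ∀ x₀ y → ¬ (⊥ ⊎ x₀ ≤[ p ] y) → Any (λ i → ¬ (i ∈ p → x₀ i ≤ y i)) (allFin n)
    cover x₀ y x₀≰y with ¬∀⟶∃¬ n _ (λ i → (i ∈? p) →-dec (x₀ i ≤? y i)) (x₀≰y ∘ inj₂)
    ... | i , x₀i≰yi = lose (∈-allFin i) x₀i≰yi

  dickson : Barred (_≤ᵥ_ {n}) (λ _ → ⊥)
  dickson = Barred-transfer (λ _ _ ()) (λ _ _ _ _ y≤z i → y≤z i ∈⊤)
                            (barred-on ⊤ (<-wellFounded _))

open Dickson using (dickson)

module _ {n : ℕ} where

  ≈ᵥ-sym : {u v : Vecℕ n} → u ≈ᵥ v → v ≈ᵥ u
  ≈ᵥ-sym u≈v i = sym (u≈v i)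

  ≈ᵥ-trans : {u v w : Vecℕ n} → u ≈ᵥ v → v ≈ᵥ w → u ≈ᵥ w
  ≈ᵥ-trans u≈v v≈w i = trans (u≈v i) (v≈w i)

  _≈ᵥ?_ : (u v : Vecℕ n) → Dec (u ≈ᵥ v)
  u ≈ᵥ? v = allFin? λ i → u i ≟ℕ v i

  ≤ᵥ⇒⊕≈ᵥ : {u v : Vecℕ n} → u ≤ᵥ v → (u ⊕ v) ≈ᵥ v
  ≤ᵥ⇒⊕≈ᵥ u≤v i = m≤n⇒m⊔n≡n (u≤v i)

  ⊕≈ᵥ⇒≤ᵥ : {u v : Vecℕ n} → (u ⊕ v) ≈ᵥ v → u ≤ᵥ v
  ⊕≈ᵥ⇒≤ᵥ {u} {v} u⊕v≈v i = subst (u i ≤_) (u⊕v≈v i) (m≤m⊔n (u i) (v i))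

  _∈ᵥ_ : Vecℕ n → List (Vecℕ n) → Set
  x ∈ᵥ xs = Any (x ≈ᵥ_) xs

  _∈ᵥ?_ : ∀ x xs → Dec (x ∈ᵥ xs)
  x ∈ᵥ? xs = any? (x ≈ᵥ?_) xs

  ⋁ : List (Vecℕ n) → Vecℕ n
  ⋁ = foldr _⊕_ 𝟘

  ∈ᵥ⇒≤ᵥ⋁ : ∀ {x} xs → x ∈ᵥ xs → x ≤ᵥ ⋁ xs
  ∈ᵥ⇒≤ᵥ⋁ (y ∷ ys) (here x≈y) i = subst (_≤ _) (sym (x≈y i)) (m≤m⊔n (y i) _)
  ∈ᵥ⇒≤ᵥ⋁ (y ∷ ys) (there x∈ys) i = ≤-trans (∈ᵥ⇒≤ᵥ⋁ ys x∈ys i) (m≤n⊔m (y i) _)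

sumᵥ : ∀ {m} → Vecℕ m → ℕ
sumᵥ {zero} _ = 0
sumᵥ {suc m} u = u fzero + sumᵥ (u ∘ fsuc)

sumᵥ-mono : ∀ {m} {u v : Vecℕ m} → u ≤ᵥ v → sumᵥ u ≤ sumᵥ v
sumᵥ-mono {zero} _ = z≤n
sumᵥ-mono {suc m} u≤v = +-mono-≤ (u≤v fzero) (sumᵥ-mono (u≤v ∘ fsuc))

sumᵥ-strict : ∀ {m} {u v : Vecℕ m} → u ≤ᵥ v → ¬ u ≈ᵥ v → sumᵥ u < sumᵥ v
sumᵥ-strict {zero} _ u≉v = ⊥-elim (u≉v λ ())
sumᵥ-strict {suc m} {u} {v} u≤v u≉v with u fzero ≟ℕ v fzero
... | yes u₀≡v₀ = +-mono-≤-< (≤-reflexive u₀≡v₀) (sumᵥ-strict (u≤v ∘ fsuc) tails≉)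
  where
  tails≉ : ¬ (u ∘ fsuc) ≈ᵥ (v ∘ fsuc)
  tails≉ tails≈ = u≉v λ { fzero → u₀≡v₀ ; (fsuc i) → tails≈ i }
... | no u₀≢v₀ = +-mono-<-≤ (≤∧≢⇒< (u≤v fzero) u₀≢v₀) (sumᵥ-mono (u≤v ∘ fsuc))

permute-isAutomorphism : ∀ {n} {C : Subset n} (π : Perm n) →
                         MapsOnto C (permute π) → IsAutomorphism C (permute π)
permute-isAutomorphism {C = C} π (into , onto) = record
  { maps-into  = into
  ; respects   = λ _ _ u≈v j → u≈v (from j)
  ; injective  = injective
  ; surjective = onto
  ; hom        = λ _ _ _ → refl
  }
  where
  open Inverse π using (to; from; strictlyInverseʳ)
  injective : ∀ {u v} → C u → C v → permute π u ≈ᵥ permute π v → u ≈ᵥ v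
  injective {u} {v} _ _ πu≈πv i =
    subst (λ k → u k ≡ v k) (strictlyInverseʳ i) (πu≈πv (to i))

permute-fixed⇒≡ : ∀ {n} (π : Perm n) {J : Vecℕ n} {i j} →
                  Inverse.to π i ≡ j → permute π J ≈ᵥ J → J i ≡ J j
permute-fixed⇒≡ π {J} {i} {j} πi≡j πJ≈J = begin
  J i             ≡⟨ cong J (sym (strictlyInverseʳ i)) ⟩
  J (from (to i)) ≡⟨ cong (J ∘ from) πi≡j ⟩
  J (from j)      ≡⟨ πJ≈J j ⟩
  J j             ∎
  where
  open ≡-Reasoning
  open Inverse π using (to; from; strictlyInverseʳ)

module Automorphisms {n : ℕ} (C : Subset n) (C-submonoid : IsSubmonoid C) where
  open IsSubmonoid C-submonoid

  ⋁-closed : ∀ {xs} → All C xs → C (⋁ xs)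
  ⋁-closed [] = has-0
  ⋁-closed (x∈C ∷ xs∈C) = closed x∈C (⋁-closed xs∈C)

  record Automorphism : Set where
    field
      apply          : Vecℕ n → Vecℕ n
      isAutomorphism : IsAutomorphism C apply
    open IsAutomorphism isAutomorphism public

  open Automorphism

  id-automorphism : Automorphism
  id-automorphism = record
    { apply = λ x → x
    ; isAutomorphism = record
      { maps-into = λ x∈C → x∈C ; respects = λ _ _ u≈v → u≈v ; injective = λ _ _ u≈v → u≈v
      ; surjective = λ {v} v∈C → v , v∈C , (λ _ → refl) ; hom = λ _ _ _ → refl } }

  _∘ᵃ_ : Automorphism → Automorphism → Automorphism
  β ∘ᵃ α = record
    { apply = apply β ∘ apply α
    ; isAutomorphism = record
      { maps-into  = maps-into β ∘ maps-into α
      ; respects   = λ u∈C v∈C u≈v →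
          respects β (maps-into α u∈C) (maps-into α v∈C) (respects α u∈C v∈C u≈v)
      ; injective  = λ u∈C v∈C βαu≈βαv →
          injective α u∈C v∈C (injective β (maps-into α u∈C) (maps-into α v∈C) βαu≈βαv)
      ; surjective = onto
      ; hom        = λ u∈C v∈C → ≈ᵥ-trans
          (respects β (maps-into α (closed u∈C v∈C))
                      (closed (maps-into α u∈C) (maps-into α v∈C)) (hom α u∈C v∈C))
          (hom β (maps-into α u∈C) (maps-into α v∈C)) } }
    where
    onto : ∀ {w} → C w → Σ (Vecℕ n) λ u → C u × (apply β (apply α u) ≈ᵥ w)
    onto w∈C with surjective β w∈C
    ... | v , v∈C , βv≈w with surjective α v∈C
    ... | u , u∈C , αu≈v = u , u∈C , ≈ᵥ-trans (respects β (maps-into α u∈C) v∈C αu≈v) βv≈w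

  module _ (α : Automorphism) where

    apply-mono : ∀ {u v} → C u → C v → u ≤ᵥ v → apply α u ≤ᵥ apply α v
    apply-mono u∈C v∈C u≤v = ⊕≈ᵥ⇒≤ᵥ (≈ᵥ-trans (≈ᵥ-sym (hom α u∈C v∈C))
                                        (respects α (closed u∈C v∈C) v∈C (≤ᵥ⇒⊕≈ᵥ u≤v)))

    apply-reflects : ∀ {u v} → C u → C v → apply α u ≤ᵥ apply α v → u ≤ᵥ v
    apply-reflects u∈C v∈C αu≤αv = ⊕≈ᵥ⇒≤ᵥ
      (injective α (closed u∈C v∈C) v∈C (≈ᵥ-trans (hom α u∈C v∈C) (≤ᵥ⇒⊕≈ᵥ αu≤αv)))

    apply-𝟘≤ᵥ𝟘 : apply α 𝟘 ≤ᵥ 𝟘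
    apply-𝟘≤ᵥ𝟘 i with surjective α has-0
    ... | u , u∈C , αu≈𝟘 = subst (apply α 𝟘 i ≤_) (αu≈𝟘 i) (apply-mono has-0 u∈C (λ _ → z≤n) i)

    apply-⋁-≤ᵥ : ∀ {K} xs → All C xs → All (λ x → apply α x ≤ᵥ K) xs → apply α (⋁ xs) ≤ᵥ K
    apply-⋁-≤ᵥ [] _ _ i = ≤-trans (apply-𝟘≤ᵥ𝟘 i) z≤n
    apply-⋁-≤ᵥ (x ∷ xs) (x∈C ∷ xs∈C) (αx≤K ∷ αxs≤K) i =
      subst (_≤ _) (sym (hom α x∈C (⋁-closed xs∈C) i)) (⊔-lub (αx≤K i) (apply-⋁-≤ᵥ xs xs∈C αxs≤K i))

  -- Pull α a back along β to a′ ≤ a with β a′ = α a; if a′ ≠ a, then the coordinate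
  -- sum drops and induction gives α a′ = β a′ = α a, contradicting injectivity of α.
  ≤ᵥ-on-orbit⇒≈ᵥ : (α β : Automorphism) → ∀ {a} → C a → apply α a ≤ᵥ apply β a → apply α a ≈ᵥ apply β a
  ≤ᵥ-on-orbit⇒≈ᵥ α β {a} a∈C = descend a∈C (<-wellFounded (sumᵥ a))
    where
    descend : ∀ {a} → C a → Acc _<_ (sumᵥ a) → apply α a ≤ᵥ apply β a → apply α a ≈ᵥ apply β a
    descend {a} a∈C (acc smaller) αa≤βa with surjective β (maps-into α a∈C)
    ... | a′ , a′∈C , βa′≈αa with a′ ≈ᵥ? a
    ...   | yes a′≈a = ≈ᵥ-trans (≈ᵥ-sym βa′≈αa) (respects β a′∈C a∈C a′≈a)
    ...   | no a′≉a = ⊥-elim (a′≉a (injective α a′∈C a∈C (≈ᵥ-trans αa′≈βa′ βa′≈αa)))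
      where
      a′≤a : a′ ≤ᵥ a
      a′≤a = apply-reflects β a′∈C a∈C λ i → subst (_≤ _) (sym (βa′≈αa i)) (αa≤βa i)
      αa′≤βa′ : apply α a′ ≤ᵥ apply β a′
      αa′≤βa′ i = subst (_ ≤_) (sym (βa′≈αa i)) (apply-mono α a′∈C a∈C a′≤a i)
      αa′≈βa′ : apply α a′ ≈ᵥ apply β a′
      αa′≈βa′ = descend a′∈C (smaller (sumᵥ-strict a′≤a a′≉a)) αa′≤βa′

  Orbit : Vecℕ n → Vecℕ n → Set
  Orbit c x = Σ Automorphism λ α → x ≈ᵥ apply α c

  module _ {c} (c∈C : C c) where

    Orbit⇒C : ∀ {x} → Orbit c x → C x
    Orbit⇒C (α , x≈αc) = ext (≈ᵥ-sym x≈αc) (maps-into α c∈C)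

    Orbit-apply : ∀ g {x} → Orbit c x → Orbit c (apply g x)
    Orbit-apply g (α , x≈αc) = g ∘ᵃ α , respects g (Orbit⇒C (α , x≈αc)) (maps-into α c∈C) x≈αc

    Orbit-antichain : ∀ {x y} → Orbit c x → Orbit c y → x ≤ᵥ y → y ≈ᵥ x
    Orbit-antichain (α , x≈αc) (β , y≈βc) x≤y =
      ≈ᵥ-trans y≈βc (≈ᵥ-trans (≈ᵥ-sym (≤ᵥ-on-orbit⇒≈ᵥ α β c∈C αc≤βc)) (≈ᵥ-sym x≈αc))
      where
      αc≤βc : apply α c ≤ᵥ apply β c
      αc≤βc i = subst₂ _≤_ (x≈αc i) (y≈βc i) (x≤y i)

  module FiniteOrbit (gs : List Automorphism) {c} (c∈C : C c) where

    Closed : List (Vecℕ n) → Set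
    Closed O = All (λ g → All (λ x → apply g x ∈ᵥ O) O) gs

    closed? : ∀ O → Dec (Closed O)
    closed? O = all? (λ g → all? (λ x → apply g x ∈ᵥ? O) O) gs

    escape : ∀ {O} → All (Orbit c) O → ¬ Closed O → Σ (Vecℕ n) λ y → Orbit c y × ¬ y ∈ᵥ O
    escape {O} O⊆orbit ¬closed
      with Any.satisfied (¬All⇒Any¬ (λ g → all? (λ x → apply g x ∈ᵥ? O) O) gs ¬closed)
    ... | g , ¬gO⊆O
      with All.lookupAny O⊆orbit (¬All⇒Any¬ (λ x → apply g x ∈ᵥ? O) O ¬gO⊆O)
    ... | x∈orbit , gx∉O = apply g _ , Orbit-apply c∈C g x∈orbit , gx∉O

    -- A new orbit point lies above no point of O, hence outside P, so the bar descends.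
    explore : ∀ O → All (Orbit c) O → c ∈ᵥ O → ∀ {P} → Barred _≤ᵥ_ P →
              (∀ z → P z → Any (_≤ᵥ z) O) →
              Σ (List (Vecℕ n)) λ O′ → All (Orbit c) O′ × c ∈ᵥ O′ × Closed O′
    explore O O⊆orbit c∈O {P} (bar next) P⊆↑O with closed? O
    ... | yes O-closed = O , O⊆orbit , c∈O , O-closed
    ... | no ¬closed with escape O⊆orbit ¬closed
    ...   | y , y∈orbit , y∉O =
      explore (y ∷ O) (y∈orbit ∷ O⊆orbit) (there c∈O) (next y y∉P) P∪↑y⊆↑yO
      where
      y∉P : ¬ P y
      y∉P Py = y∉O (above⇒∈ᵥ O⊆orbit (P⊆↑O y Py))
        where
        above⇒∈ᵥ : ∀ {xs} → All (Orbit c) xs → Any (_≤ᵥ y) xs → y ∈ᵥ xs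
        above⇒∈ᵥ (x∈orbit ∷ _) (here x≤y) = here (Orbit-antichain c∈C x∈orbit y∈orbit x≤y)
        above⇒∈ᵥ (_ ∷ xs⊆orbit) (there xs≤y) = there (above⇒∈ᵥ xs⊆orbit xs≤y)
      P∪↑y⊆↑yO : ∀ z → P z ⊎ y ≤ᵥ z → Any (_≤ᵥ z) (y ∷ O)
      P∪↑y⊆↑yO z (inj₁ Pz) = there (P⊆↑O z Pz)
      P∪↑y⊆↑yO z (inj₂ y≤z) = here y≤z

    closed-orbit : Σ (List (Vecℕ n)) λ O → All (Orbit c) O × c ∈ᵥ O × Closed O
    closed-orbit with dickson {n}
    ... | bar next = explore (c ∷ []) ((id-automorphism , λ _ → refl) ∷ []) (here λ _ → refl)
                             (next c λ ()) λ { z (inj₂ c≤z) → here c≤z }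

  common-fixed-point-above : (gs : List Automorphism) → ∀ {c} → C c →
    Σ (Vecℕ n) λ J → C J × c ≤ᵥ J × All (λ g → apply g J ≈ᵥ J) gs
  common-fixed-point-above gs c∈C with FiniteOrbit.closed-orbit gs c∈C
  ... | O , O⊆orbit , c∈O , O-closed =
    ⋁ O , J∈C , ∈ᵥ⇒≤ᵥ⋁ O c∈O , All.map (λ {g} → fixed {g}) O-closed
    where
    O⊆C : All C O
    O⊆C = All.map (Orbit⇒C c∈C) O⊆orbit
    J∈C : C (⋁ O)
    J∈C = ⋁-closed O⊆C
    fixed : ∀ {g} → All (λ x → apply g x ∈ᵥ O) O → apply g (⋁ O) ≈ᵥ ⋁ O
    fixed {g} gO⊆O = ≤ᵥ-on-orbit⇒≈ᵥ g id-automorphism J∈C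
      (apply-⋁-≤ᵥ g O O⊆C (All.map (∈ᵥ⇒≤ᵥ⋁ O) gO⊆O))

  permutation : (π : Perm n) → MapsOnto C (permute π) → Automorphism
  permutation π onto = record { apply = permute π ; isAutomorphism = permute-isAutomorphism π onto }

  module _ {G : Perm n → Set} (transitive : Transitive G)
           (preserves : ∀ π → G π → MapsOnto C (permute π)) where

    carry : Fin n × Fin n → Automorphism
    carry (i , j) = permutation π (preserves π π∈G)
      where π = proj₁ (transitive i j) ; π∈G = proj₁ (proj₂ (transitive i j))

    constant-fixed-point-above : (α : Automorphism) → ∀ {c} → C c →
      Σ (Vecℕ n) λ J → C J × c ≤ᵥ J × apply α J ≈ᵥ J × (∀ i j → J i ≡ J j)
    constant-fixed-point-above α c∈C
      with common-fixed-point-above (α ∷ map carry (cartesianProduct (allFin n) (allFin n))) c∈C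
    ... | J , J∈C , c≤J , αJ≈J ∷ carries-fix = J , J∈C , c≤J , αJ≈J , λ i j →
      permute-fixed⇒≡ (proj₁ (transitive i j)) (proj₂ (proj₂ (transitive i j)))
        (All.lookup carries-fix (∈-map⁺ carry (∈-cartesianProduct⁺ (∈-allFin i) (∈-allFin j))))

mainTheorem17 : (n : ℕ) (C : Subset n) → IsSubmonoid C →
                Σ (Vecℕ n) (λ c → C c × ¬ (c ≈ᵥ 𝟘)) →
                (G : Perm n → Set) → IsPermGroup G → Transitive G →
                (∀ π → G π → MapsOnto C (permute π)) →
                (φ : Vecℕ n → Vecℕ n) → IsAutomorphism C φ →
                Σ ℕ (λ r → (r > 0) × (C (const r) × (φ (const r) ≈ᵥ const r)))
mainTheorem17 n C C-submonoid (c , c∈C , c≉𝟘) G _ transitive preserves φ φ-aut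
  with Automorphisms.constant-fixed-point-above C C-submonoid transitive preserves
         (record { apply = φ ; isAutomorphism = φ-aut }) c∈C
     | ¬∀⟶∃¬ n _ (λ i → c i ≟ℕ 0) c≉𝟘
... | J , J∈C , c≤J , φJ≈J , J-constant | i₀ , ci₀≢0 =
  J i₀ , ≤-trans (n≢0⇒n>0 ci₀≢0) (c≤J i₀) , r𝟏∈C ,
  ≈ᵥ-trans (respects r𝟏∈C J∈C (≈ᵥ-sym J≈r𝟏)) (≈ᵥ-trans φJ≈J J≈r𝟏)
  where
  open IsSubmonoid C-submonoid using (ext)
  open IsAutomorphism φ-aut using (respects)

  J≈r𝟏 : J ≈ᵥ const (J i₀)
  J≈r𝟏 i = J-constant i i₀

  r𝟏∈C : C (const (J i₀))
  r𝟏∈C = ext J≈r𝟏 J∈C
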